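{- If $G$ is a bipartite graph with maximum degree $\Delta(G)\ge5$, then $$\mathrm{def}_c(G)\le\begin{cases}\displaystyle\sum_{v\in V(G),\ 3\le d_G(v)\le\Delta(G)-3}(\Delta(G)-2-d_G(v)), & \text{if }\Delta(G)\text{ is even},\\[2ex] \displaystyle\sum_{v\in V(G),\ 3\le d_G(v)\le\Delta(G)-2}(\Delta(G)-1-d_G(v)), & \text{if }\Delta(G)\text{ is odd}.\end{cases}$$
   Context: All graphs are finite, simple and undirected; $d_G(v)$ denotes the degree of $v$ and $\Delta(G)$ the maximum degree. A set $A\subseteq\{1,\dots,t\}$ is a cyclic interval modulo $t$ if $A$ or $\{1,\dots,t\}\setminus A$ is an interval of integers; a cyclic interval $t$-coloring is a proper edge coloring with colors $1,\dots,t$ in which the set of colors at every vertex is a cyclic interval modulo $t$. The cyclic deficiency $\mathrm{def}_c(G)$ is the minimum number of pendant edges whose attachment to $G$ yields a graph admitting a cyclic interval coloring; equivalently, it is the minimum over proper edge colorings $\alpha$ of $G$ with colors $1,\dots,t$ (any $t$) of $\sum_{v}$ (the minimum number of positive integers whose addition to the set of colors at $v$ makes it a cyclic interval modulo $t$). -}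

module Defs where

open import Data.Nat using (ℕ; zero; suc; _+_; _∸_; _≤_; _≤ᵇ_; _⊔_; _%_)
open import Data.Bool using (Bool; true; false; if_then_else_; _∧_)
open import Data.Fin using (Fin; toℕ)
open import Data.Fin.Subset using (Subset; _∈_; _∉_; ∁; ∣_∣)
open import Data.List using (List; tabulate; foldr)
open import Data.Nat.ListAction using (sum)
open import Data.Product using (Σ; ∃; ∃-syntax; _×_; _,_)
open import Data.Sum using (_⊎_)
open import Relation.Binary.PropositionalEquality using (_≡_; _≢_)
open import Function.Bundles using (_⇔_)

record Graph : Set where
  field
    n     : ℕ
    N     : Fin n → Subset n
    sym   : ∀ {u v} → v ∈ N u → u ∈ N v
    irrefl : ∀ {v} → v ∉ N v

open Graph public

Adj : (G : Graph) → Fin (n G) → Fin (n G) → Set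
Adj G u v = v ∈ N G u

deg : (G : Graph) → Fin (n G) → ℕ
deg G v = ∣ N G v ∣

ΣV : (G : Graph) → (Fin (n G) → ℕ) → ℕ
ΣV G f = sum (tabulate f)

-- maximum degree Δ(G)  (0 for the graph with no vertices)
maxDeg : Graph → ℕ
maxDeg G = foldr _⊔_ 0 (tabulate (deg G))

Bipartite : Graph → Set
Bipartite G = Σ (Fin (n G) → Bool) λ side →
  ∀ u v → Adj G u v → side u ≢ side v

-- Colours are Fin t; colour i ∈ Fin t stands for the integer toℕ i + 1 ∈ {1,…,t}.
-- A ⊆ {1,…,t} is an interval of integers (possibly empty).
IsInterval : ∀ {t} → Subset t → Set
IsInterval {t} A = ∃[ a ] ∃[ b ] (∀ (i : Fin t) → (i ∈ A) ⇔ (a ≤ toℕ i × toℕ i ≤ b))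

IsCyclicInterval : ∀ {t} → Subset t → Set
IsCyclicInterval A = IsInterval A ⊎ IsInterval (∁ A)

-- proper edge colouring of G with colours 1,…,t (α is only relevant on edges)
record ProperEdgeColouring (G : Graph) (t : ℕ) : Set where
  field
    α      : Fin (n G) → Fin (n G) → Fin t
    α-sym  : ∀ u v → Adj G u v → α u v ≡ α v u
    proper : ∀ v u w → Adj G v u → Adj G v w → α v u ≡ α v w → u ≡ w

open ProperEdgeColouring public

-- def_c(G) ≤ k : there is a proper edge colouring α with colours 1,…,t (some t)
-- such that the sum over v of the minimum number of colours that must be added
-- to the colour set S(v) of v to make it a cyclic interval modulo t is ≤ k.
-- The per-vertex minimum is witnessed by a cyclic interval A v ⊇ S(v); the number
-- of added colours is |A v| - |S(v)| = |A v| - d_G(v) (α is proper).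
DefcAtMost : Graph → ℕ → Set
DefcAtMost G k =
  ∃[ t ] Σ (ProperEdgeColouring G t) λ c →
    Σ (Fin (n G) → Subset t) λ A →
        (∀ v → IsCyclicInterval (A v))
      × (∀ v u → Adj G v u → α c v u ∈ A v)
      × (ΣV G (λ v → ∣ A v ∣ ∸ deg G v) ≤ k)

bound : Graph → ℕ
bound G with maxDeg G % 2
... | zero  = ΣV G (λ v → if (3 ≤ᵇ deg G v) ∧ (deg G v ≤ᵇ maxDeg G ∸ 3)
                           then maxDeg G ∸ 2 ∸ deg G v else 0)
... | suc _ = ΣV G (λ v → if (3 ≤ᵇ deg G v) ∧ (deg G v ≤ᵇ maxDeg G ∸ 2)
                           then maxDeg G ∸ 1 ∸ deg G v else 0)

module Submission where

-- Let Δ = 2k′ + 2 or 2k′ + 1 and use the 2k′ + 2 colours 0 … 2k′ + 1, grouped into k′ + 1 blocks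
-- {2a, 2a + 1}.  First orient G so that, listing the neighbours of each vertex in order and pairing them
-- off, every pair contains one outgoing and one incoming edge: this is a 2-edge-colouring (Kőnig) of the
-- bipartite multigraph whose vertices are the pairs.  Now every vertex is the tail of at most k′ + 1 and
-- the head of at most k′ + 1 arcs, so Kőnig's theorem assigns a block a to each arc such that arcs with a
-- common tail, or a common head, get different blocks; the edge is coloured 2a or 2a + 1 according to the
-- side of its tail, and the colouring is proper.  A vertex v with 3 ≤ d(v) ≤ 2k′ also gets a loop arc,
-- which reserves a block absent at v: the colours at v avoid two consecutive colours, hence lie in a
-- cyclic interval of length 2k′, at a cost of 2k′ − d(v).  A vertex of degree 2 is suppressed before
-- Kőnig's theorem is applied, so that its in-arc and out-arc share a block and it sees {2a, 2a + 1}.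
-- A vertex of degree at least 2k′ + 1 misses at most one colour, and degrees 0 and 1 are trivial.

open import Defs renaming (sym to adj-sym)

open import Data.Bool using (Bool; true; false; not; if_then_else_; _∧_; _xor_; T)
open import Data.Bool.Properties using (T-≡; ¬-not; not-¬; not-injective)
import Data.Bool.Properties as Bool
open import Data.Empty using (⊥-elim)
open import Data.Fin as Fin using (Fin; zero; suc; toℕ; punchOut; combine)
open import Data.Fin.Permutation.Components using (transpose)
open import Data.Fin.Properties
  using ( any?; all?; ¬∀⟶∃¬; injective⇒≤; punchOut-injective; toℕ-injective; suc-injective; toℕ<n
        ; toℕ-fromℕ<; *↔×; +↔⊎; 2↔Bool)
  renaming (_≟_ to _≟ᶠ_)
import Data.Fin.Properties as Fin
open import Data.Fin.Subset using (Subset; _∈_; _∉_; _∩_; _∪_; ∁; ⁅_⁆; ⊥; ⊤; _⊆_; ∣_∣)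
import Data.Fin.Subset.Properties as Subset
open import Data.List as List using (List; []; _∷_; foldr)
open import Data.List.Membership.Propositional.Properties using (∈-filter⁻; ∈-filter⁺; ∈-allFin)
open import Data.List.Relation.Unary.All as All using (All; []; _∷_)
open import Data.List.Relation.Unary.AllPairs using ([]; _∷_)
open import Data.List.Relation.Unary.Unique.Propositional using (Unique)
import Data.List.Relation.Unary.Unique.Propositional.Properties as Unique
open import Data.Maybe using (Maybe; just; nothing; _>>=_)
open import Data.Maybe.Properties using (≡-dec)
open import Data.Nat as ℕ using (ℕ; zero; suc; _+_; _*_; _∸_; _⊔_; _<_; _≤_; z≤n; s≤s)
open import Data.Nat.DivMod
  using (_/_; _%_; _mod_; m≡m%n+[m/n]*n; m%n<n; m*n%n≡0; [m+kn]%n≡m%n; m<n*o⇒m/o<n; m<n⇒m%n≡m; m<n⇒m/n≡0)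
open import Data.Nat.ListAction using (sum)
import Data.Nat.Properties as ℕ
open import Data.Product as Product using (Σ; ∃-syntax; _×_; _,_; proj₁; proj₂)
import Data.Product.Properties as Product
open import Data.Sum using (_⊎_; inj₁; inj₂)
open import Data.Sum.Function.Propositional using (_⊎-↔_)
import Data.Sum.Properties as Sum
import Data.Vec as Vec
import Data.Vec.Functional as Vector
import Data.Vec.Properties as Vec
open import Function using (_∘_)
open import Function.Bundles using (_↔_; Inverse; Injection; Equivalence; mk⇔)
open import Function.Construct.Composition using (_↔-∘_)
open import Function.Construct.Identity using (↔-id)
open import Function.Definitions using (Injective)
open import Function.Properties.Inverse using (↔⇒↣; ↔-sym)
open import Level using (0ℓ)
open import Relation.Binary using (DecidableEquality; tri<; tri≈; tri>)
open import Relation.Binary.PropositionalEquality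
open import Relation.Nullary
open import Relation.Nullary.Decidable using (_×-dec_; _→-dec_; decidable-stable; dec-true; dec-false)
open import Relation.Unary using (Pred; Decidable)

private variable
  A L R : Set
  m k t : ℕ

missing-colour : {P : Pred (Fin m) 0ℓ} → Decidable P → (c : Fin m → Fin t)
  (ι : ∀ e → P e → Fin k) → (∀ {e e′} p p′ → ι e p ≡ ι e′ p′ → e ≡ e′) →
  k < t → ∃[ a ] ∀ e → P e → c e ≢ a
missing-colour {m = m} {t = t} {k = k} {P = P} P? c ι ι-injective k<t
  with any? (λ a → all? (λ e → P? e →-dec ¬? (c e ≟ᶠ a)))
... | yes free = free
... | no ¬free = contradiction (injective⇒≤ index-injective) (ℕ.<⇒≱ k<t)
  where
    used : ∀ a → ∃[ e ] P e × c e ≡ a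
    used a with e , ¬avoids ← ¬∀⟶∃¬ m _ (λ e → P? e →-dec ¬? (c e ≟ᶠ a)) (¬free ∘ (a ,_))
      = e , decidable-stable (P? e) (λ ¬p → ¬avoids (⊥-elim ∘ ¬p))
          , decidable-stable (c e ≟ᶠ a) (λ ≢a → ¬avoids (λ _ → ≢a))

    index : Fin t → Fin k
    index a = ι (proj₁ (used a)) (proj₁ (proj₂ (used a)))

    index-injective : ∀ {a b} → index a ≡ index b → a ≡ b
    index-injective {a} {b} eq = begin
      a                    ≡⟨ proj₂ (proj₂ (used a)) ⟨
      c (proj₁ (used a))   ≡⟨ cong c (ι-injective _ _ eq) ⟩
      c (proj₁ (used b))   ≡⟨ proj₂ (proj₂ (used b)) ⟩
      b                    ∎
      where open ≡-Reasoning

module _ (i j : Fin m) where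

  transpose-matchˡ : transpose i j i ≡ j
  transpose-matchˡ rewrite dec-true (i ≟ᶠ i) refl = refl

  transpose-matchʳ : transpose i j j ≡ i
  transpose-matchʳ with j ≟ᶠ i
  ... | yes j≡i = j≡i
  ... | no _ rewrite dec-true (j ≟ᶠ j) refl = refl

  transpose-other : ∀ {x} → x ≢ i → x ≢ j → transpose i j x ≡ x
  transpose-other {x} x≢i x≢j rewrite dec-false (x ≟ᶠ i) x≢i | dec-false (x ≟ᶠ j) x≢j = refl

  transpose-involutive : ∀ x → transpose i j (transpose i j x) ≡ x
  transpose-involutive x = by-cases (x ≟ᶠ i) (x ≟ᶠ j)
    where
      by-cases : Dec (x ≡ i) → Dec (x ≡ j) → transpose i j (transpose i j x) ≡ x
      by-cases (yes refl) _ = trans (cong (transpose i j) transpose-matchˡ) transpose-matchʳ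
      by-cases (no _) (yes refl) = trans (cong (transpose i j) transpose-matchʳ) transpose-matchˡ
      by-cases (no x≢i) (no x≢j) =
        trans (cong (transpose i j) (transpose-other x≢i x≢j)) (transpose-other x≢i x≢j)

  transpose-injective : Injective _≡_ _≡_ (transpose i j)
  transpose-injective {x} {y} eq =
    trans (sym (transpose-involutive x)) (trans (cong (transpose i j) eq) (transpose-involutive y))

-- Kőnig's edge-colouring theorem

ProperAt : (Fin m → A) → A → (Fin m → Fin k) → Set
ProperAt end x c = ∀ e e′ → end e ≡ x → end e′ ≡ x → c e ≡ c e′ → e ≡ e′

Proper : (Fin m → A) → (Fin m → Fin k) → Set
Proper end c = ∀ e e′ → end e ≡ end e′ → c e ≡ c e′ → e ≡ e′

Free : (Fin m → A) → (Fin m → Fin k) → A → Fin k → Set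
Free end c x a = ∀ e → end e ≡ x → c e ≢ a

DegreeAtMost : ℕ → (Fin m → A) → Set
DegreeAtMost k end = ∀ x → ∃[ c ] ProperAt {k = k} end x c

DegreeAtMost-reindex : ∀ {m′} {end : Fin m → A} (σ : Fin m′ → Fin m) → Injective _≡_ _≡_ σ →
  DegreeAtMost k end → DegreeAtMost k (end ∘ σ)
DegreeAtMost-reindex σ σ-injective bounded x =
  proj₁ (bounded x) ∘ σ , λ e e′ p p′ eq → σ-injective (proj₂ (bounded x) (σ e) (σ e′) p p′ eq)

Proper-extend : {end : Fin (suc m) → A} {c : Fin m → Fin k} {a : Fin k} →
  Proper (end ∘ suc) c → Free (end ∘ suc) c (end zero) a → Proper end (a Vector.∷ c)
Proper-extend proper a-free zero zero _ _ = refl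
Proper-extend proper a-free zero (suc e′) eq col = ⊥-elim (a-free e′ (sym eq) (sym col))
Proper-extend proper a-free (suc e) zero eq col = ⊥-elim (a-free e eq col)
Proper-extend proper a-free (suc e) (suc e′) eq col = cong suc (proper e e′ eq col)

free-colour-at : DecidableEquality A → (end : Fin (suc m) → A) {ι : Fin (suc m) → Fin k} →
  ProperAt end (end zero) ι → (c : Fin m → Fin k) → ∃[ a ] Free (end ∘ suc) c (end zero) a
free-colour-at {k = zero} _ _ {ι} _ _ with () ← ι zero
free-colour-at {k = suc k} _≟_ end {ι} ι-proper c =
  missing-colour (λ e → end (suc e) ≟ end zero) c index index-injective (ℕ.n<1+n k)
  where
    apart : ∀ {e} → end (suc e) ≡ end zero → ι zero ≢ ι (suc e)
    apart p eq with () ← ι-proper zero _ refl p eq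

    index : ∀ e → end (suc e) ≡ end zero → Fin k
    index e p = punchOut (apart p)

    index-injective : ∀ {e e′} p p′ → index e p ≡ index e′ p′ → e ≡ e′
    index-injective p p′ eq =
      suc-injective (ι-proper _ _ p p′ (punchOut-injective (apart p) (apart p′) eq))

module EdgeLookup (_≟_ : DecidableEquality A) (end : Fin m → A) (c : Fin m → Fin k) (proper : Proper end c)
  where

  edge-at : A → Fin k → Maybe (Fin m)
  edge-at x col with any? (λ e → end e ≟ x ×-dec c e ≟ᶠ col)
  ... | yes (e , _) = just e
  ... | no _ = nothing

  edge-at-sound : ∀ {x col e} → edge-at x col ≡ just e → end e ≡ x × c e ≡ col
  edge-at-sound {x} {col} eq with any? (λ e → end e ≟ x ×-dec c e ≟ᶠ col)
  edge-at-sound refl | yes (_ , found) = found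

  edge-at-complete : ∀ {x col e} → end e ≡ x → c e ≡ col → edge-at x col ≡ just e
  edge-at-complete {x} {col} {e} p q with any? (λ e → end e ≟ x ×-dec c e ≟ᶠ col)
  ... | yes (e′ , p′ , q′) = cong just (proper e′ e (trans p′ (sym p)) (trans q′ (sym q)))
  ... | no none = contradiction (e , p , q) none

-- The chain is the a/b-alternating path that starts with the a-edge at w.  Swapping a and b along it
-- frees a at w; the path only reaches a left vertex through an a-edge, so left vertices keep a free.
module KempeChain (_≟ˡ_ : DecidableEquality L) (_≟ʳ_ : DecidableEquality R)
  (l : Fin m → L) (r : Fin m → R) (c : Fin m → Fin k) (properˡ : Proper l c) (properʳ : Proper r c)
  {a b : Fin k} (a≢b : a ≢ b) (w : R) (b-free : Free r c w b) where

  module Left = EdgeLookup _≟ˡ_ l c properˡ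
  module Right = EdgeLookup _≟ʳ_ r c properʳ

  data Step (e f : Fin m) : Set where
    via-left  : c e ≡ a → l f ≡ l e → c f ≡ b → Step e f
    via-right : c e ≡ b → r f ≡ r e → c f ≡ a → Step e f

  step : Fin m → Maybe (Fin m)
  step e with c e ≟ᶠ a | c e ≟ᶠ b
  ... | yes _ | _ = Left.edge-at (l e) b
  ... | no _ | yes _ = Right.edge-at (r e) a
  ... | no _ | no _ = nothing

  step-sound : ∀ {e f} → step e ≡ just f → Step e f
  step-sound {e} eq with c e ≟ᶠ a | c e ≟ᶠ b
  ... | yes ca | _ = let lf , cf = Left.edge-at-sound eq in via-left ca lf cf
  ... | no _ | yes cb = let rf , cf = Right.edge-at-sound eq in via-right cb rf cf

  step-complete : ∀ {e f} → Step e f → step e ≡ just f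
  step-complete {e} s with c e ≟ᶠ a | c e ≟ᶠ b | s
  ... | yes _ | _ | via-left _ lf cf = Left.edge-at-complete lf cf
  ... | yes ca | _ | via-right cb _ _ = contradiction (trans (sym ca) cb) a≢b
  ... | no ¬ca | _ | via-left ca _ _ = contradiction ca ¬ca
  ... | no _ | yes _ | via-right _ rf cf = Right.edge-at-complete rf cf
  ... | no _ | no ¬cb | via-right cb _ _ = contradiction cb ¬cb

  Step-target-colour : ∀ {e f} → Step e f → c f ≡ a ⊎ c f ≡ b
  Step-target-colour (via-left _ _ cf) = inj₂ cf
  Step-target-colour (via-right _ _ cf) = inj₁ cf

  Step-injective : ∀ {e e′ f} → Step e f → Step e′ f → e ≡ e′
  Step-injective (via-left ca lf _) (via-left ca′ lf′ _) =
    properˡ _ _ (trans (sym lf) lf′) (trans ca (sym ca′))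
  Step-injective (via-right cb rf _) (via-right cb′ rf′ _) =
    properʳ _ _ (trans (sym rf) rf′) (trans cb (sym cb′))
  Step-injective (via-left _ _ cf) (via-right _ _ cf′) = contradiction (trans (sym cf′) cf) a≢b
  Step-injective (via-right _ _ cf) (via-left _ _ cf′) = contradiction (trans (sym cf) cf′) a≢b

  chain : ℕ → Maybe (Fin m)
  chain zero = Right.edge-at w a
  chain (suc i) = chain i >>= step

  chain-start : ∀ {e} → chain 0 ≡ just e → r e ≡ w × c e ≡ a
  chain-start = Right.edge-at-sound

  chain-step : ∀ i {f} → chain (suc i) ≡ just f → ∃[ e ] chain i ≡ just e × Step e f
  chain-step i eq with chain i
  ... | just e = e , refl , step-sound eq

  chain-extend : ∀ i {e f} → chain i ≡ just e → Step e f → chain (suc i) ≡ just f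
  chain-extend i on s rewrite on = step-complete s

  chain-colour : ∀ i {e} → chain i ≡ just e → c e ≡ a ⊎ c e ≡ b
  chain-colour zero on = inj₁ (proj₂ (chain-start on))
  chain-colour (suc i) on = Step-target-colour (proj₂ (proj₂ (chain-step i on)))

  start-has-no-predecessor : ∀ {e g} → chain 0 ≡ just e → ¬ Step g e
  start-has-no-predecessor on (via-left _ _ cb) = a≢b (trans (sym (proj₂ (chain-start on))) cb)
  start-has-no-predecessor on (via-right cb rg _) = b-free _ (trans (sym rg) (proj₁ (chain-start on))) cb

  chain-injective : ∀ i j {e} → chain i ≡ just e → chain j ≡ just e → i ≡ j
  chain-injective zero zero _ _ = refl
  chain-injective zero (suc j) on on′ =
    ⊥-elim (start-has-no-predecessor on (proj₂ (proj₂ (chain-step j on′))))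
  chain-injective (suc i) zero on on′ =
    ⊥-elim (start-has-no-predecessor on′ (proj₂ (proj₂ (chain-step i on))))
  chain-injective (suc i) (suc j) on on′
    with g , on-g , s ← chain-step i on | g′ , on-g′ , s′ ← chain-step j on′
    with refl ← Step-injective s s′ = cong suc (chain-injective i j on-g on-g′)

  chain-prefix : ∀ d j {e} → chain (d + j) ≡ just e → ∃[ e′ ] chain j ≡ just e′
  chain-prefix zero j on = _ , on
  chain-prefix (suc d) j on = chain-prefix d j (proj₁ (proj₂ (chain-step (d + j) on)))

  chain-length : ∀ i {e} → chain i ≡ just e → i < m
  chain-length i on with i ℕ.<? m
  ... | yes i<m = i<m
  ... | no i≮m = contradiction (injective⇒≤ position-injective) ℕ.1+n≰n
    where
      defined : ∀ (j : Fin (suc m)) → ∃[ e ] chain (toℕ j) ≡ just e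
      defined j = chain-prefix (i ∸ toℕ j) (toℕ j) (subst (λ x → chain x ≡ just _)
        (sym (ℕ.m∸n+n≡m (ℕ.≤-trans (ℕ.s≤s⁻¹ (toℕ<n j)) (ℕ.≮⇒≥ i≮m)))) on)

      position-injective : ∀ {j j′} → proj₁ (defined j) ≡ proj₁ (defined j′) → j ≡ j′
      position-injective {j} {j′} eq = toℕ-injective (chain-injective (toℕ j) (toℕ j′)
        (proj₂ (defined j)) (subst (λ e → chain (toℕ j′) ≡ just e) (sym eq) (proj₂ (defined j′))))

  OnChain : Fin m → Set
  OnChain e = ∃[ i ] chain (toℕ {m} i) ≡ just e

  on-chain : ∀ i {e} → chain i ≡ just e → OnChain e
  on-chain i {e} on = Fin.fromℕ< i<m , subst (λ x → chain x ≡ just e) (sym (toℕ-fromℕ< i<m)) on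
    where
      i<m : i < m
      i<m = chain-length i on

  on-chain? : Decidable OnChain
  on-chain? e = any? (λ i → ≡-dec _≟ᶠ_ (chain (toℕ i)) (just e))

  chain-predecessor : ∀ i {e} → chain i ≡ just e → chain 0 ≡ just e ⊎ ∃[ g ] OnChain g × Step g e
  chain-predecessor zero on = inj₁ on
  chain-predecessor (suc i) on with g , on-g , s ← chain-step i on = inj₂ (g , on-chain i on-g , s)

  swap : Fin k → Fin k
  swap = transpose a b

  swap-a : ∀ {x y} → x ≡ a → y ≡ swap x → y ≡ b
  swap-a refl y≡ = trans y≡ (transpose-matchˡ a b)

  swap-b : ∀ {x y} → x ≡ b → y ≡ swap x → y ≡ a
  swap-b refl y≡ = trans y≡ (transpose-matchʳ a b)

  swap≡a : ∀ {x} → swap x ≡ a → x ≡ b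
  swap≡a eq = transpose-injective a b (trans eq (sym (transpose-matchʳ a b)))

  swapped : Fin m → Fin k
  swapped e = if does (on-chain? e) then swap (c e) else c e

  swapped-view : ∀ e → (OnChain e × swapped e ≡ swap (c e)) ⊎ (¬ OnChain e × swapped e ≡ c e)
  swapped-view e with on-chain? e
  ... | yes p = inj₁ (p , refl)
  ... | no ¬p = inj₂ (¬p , refl)

  closedˡ : ∀ {e e′} → OnChain e → l e′ ≡ l e → c e′ ≡ swap (c e) → OnChain e′
  closedˡ {e} {e′} (i , on) le ce with chain-colour (toℕ i) on
  ... | inj₁ ca = on-chain (suc (toℕ i)) (chain-extend (toℕ i) on (via-left ca le (swap-a ca ce)))
  ... | inj₂ cb with chain-predecessor (toℕ i) on
  ...   | inj₁ start = contradiction (trans (sym (proj₂ (chain-start start))) cb) a≢b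
  ...   | inj₂ (_ , _ , via-right _ _ ca) = contradiction (trans (sym ca) cb) a≢b
  ...   | inj₂ (g , on-g , via-left ca lg _) =
          subst OnChain (properˡ g e′ (trans (sym lg) (sym le)) (trans ca (sym (swap-b cb ce)))) on-g

  closedʳ : ∀ {e e′} → OnChain e → r e′ ≡ r e → c e′ ≡ swap (c e) → OnChain e′
  closedʳ {e} {e′} (i , on) re ce with chain-colour (toℕ i) on
  ... | inj₂ cb = on-chain (suc (toℕ i)) (chain-extend (toℕ i) on (via-right cb re (swap-b cb ce)))
  ... | inj₁ ca with chain-predecessor (toℕ i) on
  ...   | inj₁ start = ⊥-elim (b-free e′ (trans re (proj₁ (chain-start start))) (swap-a ca ce))
  ...   | inj₂ (_ , _ , via-left _ _ cb) = contradiction (trans (sym ca) cb) a≢b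
  ...   | inj₂ (g , on-g , via-right cb rg _) =
          subst OnChain (properʳ g e′ (trans (sym rg) (sym re)) (trans cb (sym (swap-a ca ce)))) on-g

  swapped-proper : ∀ {end : Fin m → A} → Proper end c →
    (∀ {e e′} → OnChain e → end e′ ≡ end e → c e′ ≡ swap (c e) → OnChain e′) → Proper end swapped
  swapped-proper proper closed e e′ eq col with swapped-view e | swapped-view e′
  ... | inj₁ (p , se) | inj₁ (p′ , se′) =
        proper e e′ eq (transpose-injective a b (trans (sym se) (trans col se′)))
  ... | inj₁ (p , se) | inj₂ (¬p′ , se′) =
        contradiction (closed p (sym eq) (trans (sym se′) (trans (sym col) se))) ¬p′
  ... | inj₂ (¬p , se) | inj₁ (p′ , se′) =
        contradiction (closed p′ eq (trans (sym se) (trans col se′))) ¬p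
  ... | inj₂ (¬p , se) | inj₂ (¬p′ , se′) = proper e e′ eq (trans (sym se) (trans col se′))

  swapped-properˡ : Proper l swapped
  swapped-properˡ = swapped-proper properˡ closedˡ

  swapped-properʳ : Proper r swapped
  swapped-properʳ = swapped-proper properʳ closedʳ

  a-free-at-w : Free r swapped w a
  a-free-at-w e re col with swapped-view e
  ... | inj₁ (_ , se) = b-free e re (swap≡a (trans (sym se) col))
  ... | inj₂ (¬p , se) = ¬p (on-chain 0 (Right.edge-at-complete re (trans (sym se) col)))

  a-free-preservedˡ : ∀ {x} → Free l c x a → Free l swapped x a
  a-free-preservedˡ a-free e le col with swapped-view e
  ... | inj₂ (_ , se) = a-free e le (trans (sym se) col)
  ... | inj₁ ((i , on) , se) with cb ← swap≡a (trans (sym se) col) | chain-predecessor (toℕ i) on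
  ...   | inj₁ start = a≢b (trans (sym (proj₂ (chain-start start))) cb)
  ...   | inj₂ (_ , _ , via-right _ _ ca) = a≢b (trans (sym ca) cb)
  ...   | inj₂ (g , _ , via-left ca lg _) = a-free g (trans (sym lg) le) ca

kempe-recolour : DecidableEquality L → DecidableEquality R → (l : Fin m → L) (r : Fin m → R)
  {c : Fin m → Fin k} → Proper l c → Proper r c → ∀ {x w a b} → Free l c x a → Free r c w b →
  ∃[ c′ ] Proper l c′ × Proper r c′ × Free l c′ x a × Free r c′ w a
kempe-recolour _≟ˡ_ _≟ʳ_ l r {c} properˡ properʳ {w = w} {a} {b} a-free b-free with a ≟ᶠ b
... | yes refl = c , properˡ , properʳ , a-free , b-free
... | no a≢b = swapped , swapped-properˡ , swapped-properʳ , a-free-preservedˡ a-free , a-free-at-w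
  where open KempeChain _≟ˡ_ _≟ʳ_ l r c properˡ properʳ a≢b w b-free

kőnig : DecidableEquality L → DecidableEquality R → (l : Fin m → L) (r : Fin m → R) →
  DegreeAtMost k l → DegreeAtMost k r → Σ (Fin m → Fin k) λ c → Proper l c × Proper r c
kőnig {m = zero} _ _ _ _ _ _ = (λ ()) , (λ ()) , (λ ())
kőnig {m = suc m} _≟ˡ_ _≟ʳ_ l r boundedˡ boundedʳ
  with c₀ , properˡ₀ , properʳ₀ ← kőnig _≟ˡ_ _≟ʳ_ (l ∘ suc) (r ∘ suc)
         (DegreeAtMost-reindex suc suc-injective boundedˡ) (DegreeAtMost-reindex suc suc-injective boundedʳ)
  with a , a-free ← free-colour-at _≟ˡ_ l (proj₂ (boundedˡ (l zero))) c₀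
     | b , b-free ← free-colour-at _≟ʳ_ r (proj₂ (boundedʳ (r zero))) c₀
  with c , properˡ , properʳ , a-freeˡ , a-freeʳ
         ← kempe-recolour _≟ˡ_ _≟ʳ_ (l ∘ suc) (r ∘ suc) properˡ₀ properʳ₀ a-free b-free
  = a Vector.∷ c , Proper-extend properˡ a-freeˡ , Proper-extend properʳ a-freeʳ

-- Kőnig's theorem with prescribed equal colours

AtMostOneAt : (Fin m → A) → A → Set
AtMostOneAt end x = ∀ e e′ → end e ≡ x → end e′ ≡ x → e ≡ e′

AtMostOneAt-reindex : ∀ {m′} {end : Fin m → A} {x} (σ : Fin m′ → Fin m) → Injective _≡_ _≡_ σ →
  AtMostOneAt end x → AtMostOneAt (end ∘ σ) x
AtMostOneAt-reindex σ σ-injective one e e′ p p′ = σ-injective (one (σ e) (σ e′) p p′)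

Joined : (Fin m → L) → (Fin m → R) → (Fin m → Fin k) → L → R → Set
Joined l r c x y = ∀ e e′ → l e ≡ x → r e′ ≡ y → c e ≡ c e′

-- Suppressing a vertex whose two copies x and y lie on the single edges e₁ and e₂: in l′ the edge e₁
-- takes over the left end of e₂, which contracts the path through the vertex, and e₂ becomes an isolated
-- edge from x to y; colouring e₂ like e₁ afterwards joins x and y.
module Contraction {l : Fin m → L} {r : Fin m → R} {x : L} {y : R} {e₁ e₂ : Fin m}
  (l-e₁ : l e₁ ≡ x) (r-e₂ : r e₂ ≡ y) (one-at-x : AtMostOneAt l x) (one-at-y : AtMostOneAt r y) where

  τ : Fin m → Fin m
  τ = transpose e₁ e₂

  τ-injective : Injective _≡_ _≡_ τ
  τ-injective = transpose-injective e₁ e₂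

  l′ : Fin m → L
  l′ = l ∘ τ

  l′∘τ : ∀ e → l′ (τ e) ≡ l e
  l′∘τ e = cong l (transpose-involutive e₁ e₂ e)

  merge : Fin m → Fin m
  merge e = if does (e ≟ᶠ e₂) then e₁ else e

  merge-other : ∀ {e} → e ≢ e₂ → merge e ≡ e
  merge-other {e} e≢e₂ rewrite dec-false (e ≟ᶠ e₂) e≢e₂ = refl

  merge-e₂ : merge e₂ ≡ e₁
  merge-e₂ rewrite dec-true (e₂ ≟ᶠ e₂) refl = refl

  merge-e₁ : merge e₁ ≡ e₁
  merge-e₁ = Bool.if-eta (does (e₁ ≟ᶠ e₂))

  merge≡τ : ∀ {e} → e ≢ e₁ → merge e ≡ τ e
  merge≡τ {e} e≢e₁ = by-cases (e ≟ᶠ e₂)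
    where
      by-cases : Dec (e ≡ e₂) → merge e ≡ τ e
      by-cases (yes refl) = trans merge-e₂ (sym (transpose-matchʳ e₁ e₂))
      by-cases (no e≢e₂) = trans (merge-other e≢e₂) (sym (transpose-other e₁ e₂ e≢e₁ e≢e₂))

  module _ {k} (c′ : Fin m → Fin k) where

    c : Fin m → Fin k
    c = c′ ∘ merge

    properˡ : Proper l′ c′ → Proper l c
    properˡ proper′ e f le col with e ≟ᶠ e₁ | f ≟ᶠ e₁
    ... | yes refl | _ = one-at-x e f l-e₁ (trans (sym le) l-e₁)
    ... | _ | yes refl = one-at-x e f (trans le l-e₁) l-e₁
    ... | no e≢e₁ | no f≢e₁ = τ-injective (proper′ (τ e) (τ f)
          (trans (l′∘τ e) (trans le (sym (l′∘τ f))))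
          (trans (cong c′ (sym (merge≡τ e≢e₁))) (trans col (cong c′ (merge≡τ f≢e₁)))))

    properʳ : Proper r c′ → Proper r c
    properʳ proper′ e f re col = by-cases (e ≟ᶠ e₂) (f ≟ᶠ e₂)
      where
        by-cases : Dec (e ≡ e₂) → Dec (f ≡ e₂) → e ≡ f
        by-cases (yes refl) _ = one-at-y e f r-e₂ (trans (sym re) r-e₂)
        by-cases _ (yes refl) = one-at-y e f (trans re r-e₂) r-e₂
        by-cases (no e≢e₂) (no f≢e₂) = proper′ e f re
          (trans (cong c′ (sym (merge-other e≢e₂))) (trans col (cong c′ (merge-other f≢e₂))))

    joined : Joined l r c x y
    joined e e′ le re′ rewrite one-at-x e e₁ le l-e₁ | one-at-y e′ e₂ re′ r-e₂ =
      cong c′ (trans merge-e₁ (sym merge-e₂))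

    joined-elsewhere : ∀ {x′ y′} → x′ ≢ x → y′ ≢ y → Joined l′ r c′ x′ y′ → Joined l r c x′ y′
    joined-elsewhere x′≢x y′≢y joined′ e e′ le re′ = begin
      c′ (merge e)  ≡⟨ cong c′ (merge≡τ {e} (λ { refl → x′≢x (trans (sym le) l-e₁) })) ⟩
      c′ (τ e)      ≡⟨ joined′ (τ e) e′ (trans (l′∘τ e) le) re′ ⟩
      c′ e′         ≡⟨ cong c′ (merge-other {e′} (λ { refl → y′≢y (trans (sym re′) r-e₂) })) ⟨
      c′ (merge e′) ∎
      where open ≡-Reasoning

module _ (_≟ˡ_ : DecidableEquality L) (_≟ʳ_ : DecidableEquality R) {V : Set} {lk : V → L} {rk : V → R}
  (lk-injective : Injective _≡_ _≡_ lk) (rk-injective : Injective _≡_ _≡_ rk) where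

  kőnig-linked : (vs : List V) → Unique vs → (l : Fin m → L) (r : Fin m → R) →
    DegreeAtMost k l → DegreeAtMost k r → All (λ v → AtMostOneAt l (lk v) × AtMostOneAt r (rk v)) vs →
    Σ (Fin m → Fin k) λ c → Proper l c × Proper r c × All (λ v → Joined l r c (lk v) (rk v)) vs
  kőnig-linked [] _ l r boundedˡ boundedʳ [] =
    let c , properˡ , properʳ = kőnig _≟ˡ_ _≟ʳ_ l r boundedˡ boundedʳ in c , properˡ , properʳ , []
  kőnig-linked (v ∷ vs) (v∉vs ∷ unique) l r boundedˡ boundedʳ ((one-at-lk , one-at-rk) ∷ ones)
    with any? (λ e → l e ≟ˡ lk v) ×-dec any? (λ e → r e ≟ʳ rk v)
  ... | no none =
    let c , properˡ , properʳ , joined = kőnig-linked vs unique l r boundedˡ boundedʳ ones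
    in c , properˡ , properʳ , (λ e e′ le re′ → contradiction ((e , le) , (e′ , re′)) none) ∷ joined
  ... | yes ((e₁ , l-e₁) , (e₂ , r-e₂)) =
    let c′ , properˡ′ , properʳ′ , joined′ = kőnig-linked vs unique l′ r
          (DegreeAtMost-reindex τ τ-injective boundedˡ) boundedʳ
          (All.map (Product.map₁ (AtMostOneAt-reindex τ τ-injective)) ones)
    in c c′ , properˡ c′ properˡ′ , properʳ c′ properʳ′ , joined c′ ∷
       All.zipWith (λ (v≢u , joined′ᵤ) →
                      joined-elsewhere c′ (v≢u ∘ lk-injective ∘ sym) (v≢u ∘ rk-injective ∘ sym) joined′ᵤ)
                   (v∉vs , joined′)
    where open Contraction l-e₁ r-e₂ one-at-lk one-at-rk

-- The edges are the active codes p : P, numbered through code; an inactive code e becomes an isolated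
-- edge at the private vertex inj₂ e, which keeps end total without affecting properness.
module CodedEdges {M : ℕ} {P : Set} (code : Fin M ↔ P) (Active : P → Set) (active? : Decidable Active) where

  open Inverse code using (strictlyInverseˡ) renaming (to to decode; from to encode)

  decode-injective : Injective _≡_ _≡_ decode
  decode-injective = Injection.injective (↔⇒↣ code)

  module _ (f : P → A) where

    end : Fin M → A ⊎ Fin M
    end e = if does (active? (decode e)) then inj₁ (f (decode e)) else inj₂ e

    end-encode : ∀ {p} → Active p → end (encode p) ≡ inj₁ (f p)
    end-encode {p} act rewrite strictlyInverseˡ p | dec-true (active? p) act = refl

    end≡inj₁ : ∀ e {x} → end e ≡ inj₁ x → Active (decode e) × f (decode e) ≡ x
    end≡inj₁ e eq with active? (decode e)
    end≡inj₁ e refl | yes act = act , refl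

    end≡inj₂ : ∀ e {j} → end e ≡ inj₂ j → e ≡ j
    end≡inj₂ e eq with active? (decode e)
    end≡inj₂ e refl | no _ = refl

    end-degree : (ι : P → Fin k) → (∀ {p q} → Active p → Active q → f p ≡ f q → ι p ≡ ι q → p ≡ q) →
      DegreeAtMost k end
    end-degree ι ι-injective node = ι ∘ decode , proper-at node
      where
        proper-at : ∀ node e e′ → end e ≡ node → end e′ ≡ node → ι (decode e) ≡ ι (decode e′) → e ≡ e′
        proper-at (inj₁ x) e e′ p p′ eq with act , fe ← end≡inj₁ e p | act′ , fe′ ← end≡inj₁ e′ p′ =
          decode-injective (ι-injective act act′ (trans fe (sym fe′)) eq)
        proper-at (inj₂ j) e e′ p p′ _ = trans (end≡inj₂ e p) (sym (end≡inj₂ e′ p′))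

    end-at-most-one : (ι : P → Fin k) → (∀ {p q} → Active p → Active q → f p ≡ f q → ι p ≡ ι q → p ≡ q) →
      ∀ {x} → (∀ {p q} → Active p → Active q → f p ≡ x → f q ≡ x → ι p ≡ ι q) → AtMostOneAt end (inj₁ x)
    end-at-most-one ι ι-injective same e e′ p p′ with act , fe ← end≡inj₁ e p | act′ , fe′ ← end≡inj₁ e′ p′ =
      decode-injective (ι-injective act act′ (trans fe (sym fe′)) (same act act′ fe fe′))

    proper-on-codes : ∀ {c : Fin M → Fin k} → Proper end c →
      ∀ {p q} → Active p → Active q → f p ≡ f q → c (encode p) ≡ c (encode q) → p ≡ q
    proper-on-codes proper {p} {q} act act′ fp≡fq eq = begin
      p                 ≡⟨ strictlyInverseˡ p ⟨
      decode (encode p) ≡⟨ cong decode (proper _ _ ends eq) ⟩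
      decode (encode q) ≡⟨ strictlyInverseˡ q ⟩
      q                 ∎
      where
        open ≡-Reasoning
        ends : end (encode p) ≡ end (encode q)
        ends = trans (end-encode act) (trans (cong inj₁ fp≡fq) (sym (end-encode act′)))

-- Ranks of neighbours

below : Fin t → Subset t
below u = Vec.tabulate (λ i → toℕ i ℕ.<ᵇ toℕ u)

lookup-below : ∀ (i u : Fin t) → Vec.lookup (below u) i ≡ (toℕ i ℕ.<ᵇ toℕ u)
lookup-below i u = Vec.lookup∘tabulate _ i

∈-below⁻ : ∀ {i u : Fin t} → i ∈ below u → i Fin.< u
∈-below⁻ {i = i} {u} i∈ =
  ℕ.<ᵇ⇒< (toℕ i) (toℕ u) (Equivalence.from T-≡ (trans (sym (lookup-below i u)) (Vec.[]=⇒lookup i∈)))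

∈-below⁺ : ∀ {i u : Fin t} → i Fin.< u → i ∈ below u
∈-below⁺ {i = i} {u} i<u =
  Vec.lookup⇒[]= i (below u) (trans (lookup-below i u) (Equivalence.to T-≡ (ℕ.<⇒<ᵇ i<u)))

rank : (G : Graph) → Fin (n G) → Fin (n G) → ℕ
rank G v u = ∣ N G v ∩ below u ∣

module _ (G : Graph) {v : Fin (n G)} where

  ∉-rank-set : ∀ u → u ∉ N G v ∩ below u
  ∉-rank-set u u∈ = Fin.<-irrefl refl (∈-below⁻ (proj₂ (Subset.x∈p∩q⁻ (N G v) (below u) u∈)))

  rank<deg : ∀ {u} → u ∈ N G v → rank G v u < deg G v
  rank<deg {u} u∈N = Subset.p⊂q⇒∣p∣<∣q∣ (Subset.p∩q⊆p (N G v) (below u) , u , u∈N , ∉-rank-set u)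

  rank-monotone : ∀ {u u′} → u ∈ N G v → u Fin.< u′ → rank G v u < rank G v u′
  rank-monotone {u} {u′} u∈N u<u′ =
    Subset.p⊂q⇒∣p∣<∣q∣ (⊆ , u , Subset.x∈p∩q⁺ (u∈N , ∈-below⁺ u<u′) , ∉-rank-set u)
    where
      ⊆ : N G v ∩ below u ⊆ N G v ∩ below u′
      ⊆ i∈ with i∈N , i<u ← Subset.x∈p∩q⁻ (N G v) (below u) i∈ =
        Subset.x∈p∩q⁺ (i∈N , ∈-below⁺ (Fin.<-trans (∈-below⁻ i<u) u<u′))

  rank-injective : ∀ {u u′} → u ∈ N G v → u′ ∈ N G v → rank G v u ≡ rank G v u′ → u ≡ u′
  rank-injective {u} {u′} u∈N u′∈N eq with Fin.<-cmp u u′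
  ... | tri< u<u′ _ _ = contradiction eq (ℕ.<⇒≢ (rank-monotone u∈N u<u′))
  ... | tri≈ _ u≡u′ _ = u≡u′
  ... | tri> _ _ u′<u = contradiction (sym eq) (ℕ.<⇒≢ (rank-monotone u′∈N u′<u))

  rank-index : ∀ {u} → u ∈ N G v → Fin (deg G v)
  rank-index u∈N = Fin.fromℕ< (rank<deg u∈N)

  rank-index-injective : ∀ {u u′} u∈N u′∈N → rank-index {u} u∈N ≡ rank-index {u′} u′∈N → u ≡ u′
  rank-index-injective u∈N u′∈N eq =
    rank-injective u∈N u′∈N (trans (sym (toℕ-fromℕ< _)) (trans (cong toℕ eq) (toℕ-fromℕ< _)))

-- Balanced orientations of bipartite graphs

div-mod-injective : ∀ d .{{_ : ℕ.NonZero d}} {x y} → x / d ≡ y / d → x mod d ≡ y mod d → x ≡ y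
div-mod-injective d {x} {y} q r = begin
  x                   ≡⟨ m≡m%n+[m/n]*n x d ⟩
  x % d + x / d * d   ≡⟨ cong₂ (λ r q → r + q * d) remainders q ⟩
  y % d + y / d * d   ≡⟨ m≡m%n+[m/n]*n y d ⟨
  y                   ∎
  where
    open ≡-Reasoning
    remainders : x % d ≡ y % d
    remainders = trans (sym (toℕ-fromℕ< _)) (trans (cong toℕ r) (toℕ-fromℕ< _))

xor-cancelˡ : ∀ x {y z} → x xor y ≡ x xor z → y ≡ z
xor-cancelˡ true = not-injective
xor-cancelˡ false eq = eq

side-opposite : ∀ G ((side , _) : Bipartite G) {v u} → u ∈ N G v → side u ≡ not (side v)
side-opposite G (_ , bipartite) u∈N = ¬-not (bipartite _ _ (adj-sym G u∈N))

slot : (G : Graph) → Fin (n G) → Fin (n G) → ℕ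
slot G v u = rank G v u / 2

record BalancedOrientation (G : Graph) : Set where
  field
    out : Fin (n G) → Fin (n G) → Bool
    out-antisym : ∀ {v u} → u ∈ N G v → out u v ≡ not (out v u)
    slot-injective : ∀ {v u u′} → u ∈ N G v → u′ ∈ N G v →
      out v u ≡ out v u′ → slot G v u ≡ slot G v u′ → u ≡ u′

-- The edge {v , u} is coded by its endpoints, true side first; its two ends are the slots it occupies.
-- A 2-colouring β with distinct colours within each slot orients an edge away from its true end when β
-- is 0, so the two edges of a slot point in opposite directions.
balanced-orientation : (G : Graph) → Bipartite G → BalancedOrientation G
balanced-orientation G bipartite@(side , _) = record
  { out = out ; out-antisym = out-antisym ; slot-injective = slot-injective }
  where
    V : Set
    V = Fin (n G)

    Active : V × V → Set
    Active (x , y) = side x ≡ true × y ∈ N G x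

    open CodedEdges (*↔× {n G} {n G}) Active (λ (x , y) → (side x Bool.≟ true) ×-dec (y Subset.∈? N G x))
    open Inverse (*↔× {n G} {n G}) using () renaming (from to encode)

    left right : V × V → V × ℕ
    left (x , y) = x , slot G x y
    right (x , y) = y , slot G y x

    parityˡ parityʳ : V × V → Fin 2
    parityˡ (x , y) = rank G x y mod 2
    parityʳ (x , y) = rank G y x mod 2

    left-injective : ∀ {p q} → Active p → Active q → left p ≡ left q → parityˡ p ≡ parityˡ q → p ≡ q
    left-injective {x , y} (_ , y∈N) (_ , y′∈N) eq p≡ with refl ← cong proj₁ eq =
      cong (x ,_) (rank-injective G y∈N y′∈N (div-mod-injective 2 (cong proj₂ eq) p≡))

    right-injective : ∀ {p q} → Active p → Active q → right p ≡ right q → parityʳ p ≡ parityʳ q → p ≡ q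
    right-injective {x , y} (_ , y∈N) (_ , y′∈N) eq p≡ with refl ← cong proj₁ eq =
      cong (_, y) (rank-injective G (adj-sym G y∈N) (adj-sym G y′∈N) (div-mod-injective 2 (cong proj₂ eq) p≡))

    _≟slot_ : DecidableEquality ((V × ℕ) ⊎ Fin (n G * n G))
    _≟slot_ = Sum.≡-dec (Product.≡-dec _≟ᶠ_ ℕ._≟_) _≟ᶠ_

    two-colouring : Σ (Fin (n G * n G) → Fin 2) λ c → Proper (end left) c × Proper (end right) c
    two-colouring = kőnig _≟slot_ _≟slot_ (end left) (end right)
      (end-degree left parityˡ left-injective) (end-degree right parityʳ right-injective)

    β : Fin (n G * n G) → Fin 2
    β = proj₁ two-colouring

    edge : V → V → V × V
    edge v u = if side v then (v , u) else (u , v)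

    edge-sym : ∀ {v u} → u ∈ N G v → edge u v ≡ edge v u
    edge-sym {v} u∈N = trans (Bool.if-cong (side-opposite G bipartite u∈N)) (Bool.if-not (side v))

    bit : V → V → Bool
    bit v u = Inverse.to 2↔Bool (β (encode (edge v u)))

    out : V → V → Bool
    out v u = side v xor bit v u

    out-antisym : ∀ {v u} → u ∈ N G v → out u v ≡ not (out v u)
    out-antisym {v} {u} u∈N = begin
      side u xor bit u v        ≡⟨ cong₂ _xor_ (side-opposite G bipartite u∈N)
                                     (cong (Inverse.to 2↔Bool ∘ β ∘ encode) (edge-sym u∈N)) ⟩
      not (side v) xor bit v u  ≡⟨ Bool.not-distribˡ-xor (side v) _ ⟨
      not (out v u)             ∎
      where open ≡-Reasoning

    slot-injective : ∀ {v u u′} → u ∈ N G v → u′ ∈ N G v →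
      out v u ≡ out v u′ → slot G v u ≡ slot G v u′ → u ≡ u′
    slot-injective {v} {u} {u′} u∈N u′∈N o s = by-side (side v) refl
      where
        same-colour : ∀ {b} → side v ≡ b →
          β (encode (if b then (v , u) else (u , v))) ≡ β (encode (if b then (v , u′) else (u′ , v)))
        same-colour sv = subst₂ (λ p q → β (encode p) ≡ β (encode q)) (Bool.if-cong sv) (Bool.if-cong sv)
          (Injection.injective (↔⇒↣ 2↔Bool) (xor-cancelˡ (side v) o))

        by-side : ∀ b → side v ≡ b → u ≡ u′
        by-side true sv = cong proj₂ (proper-on-codes left (proj₁ (proj₂ two-colouring))
          (sv , u∈N) (sv , u′∈N) (cong (v ,_) s) (same-colour sv))
        by-side false sv = cong proj₁ (proper-on-codes right (proj₂ (proj₂ two-colouring))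
          (trans (side-opposite G bipartite u∈N) (cong not sv) , adj-sym G u∈N)
          (trans (side-opposite G bipartite u′∈N) (cong not sv) , adj-sym G u′∈N)
          (cong (v ,_) s) (same-colour sv))

-- Cyclic intervals and covers

⊥-interval : IsInterval (⊥ {t})
⊥-interval = 1 , 0 , λ i → mk⇔ (λ i∈⊥ → contradiction i∈⊥ Subset.∉⊥)
  (λ (1≤i , i≤0) → contradiction (ℕ.≤-trans 1≤i i≤0) λ ())

⊤-interval : IsInterval (⊤ {t})
⊤-interval {t} = 0 , t , λ i → mk⇔ (λ _ → z≤n , Fin.toℕ≤n i) (λ _ → Subset.∈⊤)

⁅⁆-interval : (x : Fin t) → IsInterval ⁅ x ⁆
⁅⁆-interval x = toℕ x , toℕ x , λ i → mk⇔
  (λ i∈ → let i≡x = cong toℕ (Subset.x∈⁅y⁆⇒x≡y x i∈) in ℕ.≤-reflexive (sym i≡x) , ℕ.≤-reflexive i≡x)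
  (λ (x≤i , i≤x) → subst (_∈ ⁅ x ⁆) (toℕ-injective (ℕ.≤-antisym x≤i i≤x)) (Subset.x∈⁅x⁆ x))

adjacent-interval : (x y : Fin t) → toℕ y ≡ suc (toℕ x) → IsInterval (⁅ x ⁆ ∪ ⁅ y ⁆)
adjacent-interval x y y≡1+x = toℕ x , suc (toℕ x) , λ i → mk⇔ to from
  where
    to : ∀ {i} → i ∈ ⁅ x ⁆ ∪ ⁅ y ⁆ → toℕ x ≤ toℕ i × toℕ i ≤ suc (toℕ x)
    to i∈ with Subset.x∈p∪q⁻ ⁅ x ⁆ ⁅ y ⁆ i∈
    ... | inj₁ i∈x with refl ← Subset.x∈⁅y⁆⇒x≡y x i∈x = ℕ.≤-refl , ℕ.n≤1+n _
    ... | inj₂ i∈y with refl ← Subset.x∈⁅y⁆⇒x≡y y i∈y =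
          ℕ.≤-trans (ℕ.n≤1+n _) (ℕ.≤-reflexive (sym y≡1+x)) , ℕ.≤-reflexive y≡1+x

    from : ∀ {i} → toℕ x ≤ toℕ i × toℕ i ≤ suc (toℕ x) → i ∈ ⁅ x ⁆ ∪ ⁅ y ⁆
    from {i} (x≤i , i≤1+x) with ℕ.m≤n⇒m<n∨m≡n i≤1+x
    ... | inj₁ i<1+x = Subset.x∈p∪q⁺ (inj₁
          (subst (_∈ ⁅ x ⁆) (toℕ-injective (ℕ.≤-antisym x≤i (ℕ.s≤s⁻¹ i<1+x))) (Subset.x∈⁅x⁆ x)))
    ... | inj₂ i≡1+x = Subset.x∈p∪q⁺ (inj₂
          (subst (_∈ ⁅ y ⁆) (toℕ-injective (trans y≡1+x (sym i≡1+x))) (Subset.x∈⁅x⁆ y)))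

∁-cyclic : {p : Subset t} → IsInterval p → IsCyclicInterval (∁ p)
∁-cyclic (a , b , p⇔) = inj₂ (a , b , λ i → mk⇔
  (Equivalence.to (p⇔ i) ∘ Subset.x∉∁p⇒x∈p ∘ Subset.x∈∁p⇒x∉p)
  (Subset.x∉p⇒x∈∁p ∘ Subset.x∈p⇒x∉∁p ∘ Equivalence.from (p⇔ i)))

∣p∪q∣≤∣p∣+∣q∣ : (p q : Subset t) → ∣ p ∪ q ∣ ≤ ∣ p ∣ + ∣ q ∣
∣p∪q∣≤∣p∣+∣q∣ Vec.[] Vec.[] = z≤n
∣p∪q∣≤∣p∣+∣q∣ (true Vec.∷ p) (true Vec.∷ q) =
  s≤s (ℕ.≤-trans (∣p∪q∣≤∣p∣+∣q∣ p q) (ℕ.+-monoʳ-≤ ∣ p ∣ (ℕ.n≤1+n ∣ q ∣)))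
∣p∪q∣≤∣p∣+∣q∣ (true Vec.∷ p) (false Vec.∷ q) = s≤s (∣p∪q∣≤∣p∣+∣q∣ p q)
∣p∪q∣≤∣p∣+∣q∣ (false Vec.∷ p) (true Vec.∷ q) =
  ℕ.≤-trans (s≤s (∣p∪q∣≤∣p∣+∣q∣ p q)) (ℕ.≤-reflexive (sym (ℕ.+-suc ∣ p ∣ ∣ q ∣)))
∣p∪q∣≤∣p∣+∣q∣ (false Vec.∷ p) (false Vec.∷ q) = ∣p∪q∣≤∣p∣+∣q∣ p q

block : Fin m → Subset (m * 2)
block a = ⁅ combine a zero ⁆ ∪ ⁅ combine a (suc zero) ⁆

block-interval : (a : Fin m) → IsInterval (block a)
block-interval a = adjacent-interval _ _ (begin
  toℕ (combine a (suc zero))  ≡⟨ Fin.toℕ-combine a (suc zero) ⟩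
  2 * toℕ a + 1               ≡⟨ ℕ.+-suc (2 * toℕ a) 0 ⟩
  suc (2 * toℕ a + 0)         ≡⟨ cong suc (Fin.toℕ-combine a zero) ⟨
  suc (toℕ (combine a zero))  ∎)
  where open ≡-Reasoning

∈-block : (a : Fin m) (j : Fin 2) → combine a j ∈ block a
∈-block a zero = Subset.x∈p∪q⁺ (inj₁ (Subset.x∈⁅x⁆ _))
∈-block a (suc zero) = Subset.x∈p∪q⁺ (inj₂ (Subset.x∈⁅x⁆ _))

∈-block⁻ : ∀ {a b : Fin m} {j} → combine b j ∈ block a → b ≡ a
∈-block⁻ {a = a} {b} {j} b∈ with Subset.x∈p∪q⁻ ⁅ combine a zero ⁆ _ b∈
... | inj₁ b∈₀ = proj₁ (Fin.combine-injective b j a zero (Subset.x∈⁅y⁆⇒x≡y _ b∈₀))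
... | inj₂ b∈₁ = proj₁ (Fin.combine-injective b j a (suc zero) (Subset.x∈⁅y⁆⇒x≡y _ b∈₁))

∣block∣≤2 : (a : Fin m) → ∣ block a ∣ ≤ 2
∣block∣≤2 a = ℕ.≤-trans (∣p∪q∣≤∣p∣+∣q∣ ⁅ combine a zero ⁆ _)
  (ℕ.≤-reflexive (cong₂ _+_ (Subset.∣⁅x⁆∣≡1 (combine a zero)) (Subset.∣⁅x⁆∣≡1 (combine a (suc zero)))))

2≤∣block∣ : (a : Fin m) → 2 ≤ ∣ block a ∣
2≤∣block∣ a = subst (_< ∣ block a ∣) (Subset.∣⁅x⁆∣≡1 (combine a zero))
  (Subset.p⊂q⇒∣p∣<∣q∣ (Subset.p⊆p∪q _ , combine a (suc zero) , ∈-block a (suc zero) , λ ∈₀ →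
    contradiction (proj₂ (Fin.combine-injective a (suc zero) a zero (Subset.x∈⁅y⁆⇒x≡y _ ∈₀))) λ ()))

record CyclicCover (G : Graph) (α : Fin (n G) → Fin (n G) → Fin t) (v : Fin (n G)) (added : ℕ) : Set where
  field
    colours : Subset t
    cyclic : IsCyclicInterval colours
    contains : ∀ u → Adj G v u → α v u ∈ colours
    added≤ : ∣ colours ∣ ∸ deg G v ≤ added

CyclicCover-weaken : ∀ {G} {α : Fin (n G) → Fin (n G) → Fin t} {v a a′} →
  a ≤ a′ → CyclicCover G α v a → CyclicCover G α v a′
CyclicCover-weaken a≤a′ cover =
  record { CyclicCover cover ; added≤ = ℕ.≤-trans (CyclicCover.added≤ cover) a≤a′ }

sum-tabulate-mono : ∀ {f g : Fin m → ℕ} → (∀ i → f i ≤ g i) → sum (List.tabulate f) ≤ sum (List.tabulate g)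
sum-tabulate-mono {m = zero} _ = z≤n
sum-tabulate-mono {m = suc m} f≤g = ℕ.+-mono-≤ (f≤g zero) (sum-tabulate-mono (f≤g ∘ suc))

DefcAtMost-from-covers : ∀ {G} (c : ProperEdgeColouring G t) (added : Fin (n G) → ℕ) →
  (∀ v → CyclicCover G (α c) v (added v)) → DefcAtMost G (ΣV G added)
DefcAtMost-from-covers {t} c added cover =
  t , c , colours ∘ cover , cyclic ∘ cover , contains ∘ cover , sum-tabulate-mono (added≤ ∘ cover)
  where open CyclicCover

-- excess (Δ ∸ 2) d and excess (Δ ∸ 1) d are the summands of bound for even and odd Δ respectively.
excess : ℕ → ℕ → ℕ
excess K d = if (3 ℕ.≤ᵇ d) ∧ (d ℕ.≤ᵇ K ∸ 1) then K ∸ d else 0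

∸≤excess : ∀ {K d} → 3 ≤ d → d ≤ K → K ∸ d ≤ excess K d
∸≤excess {K} {d} 3≤d d≤K with 3 ℕ.≤ᵇ d in 3≤ᵇd | d ℕ.≤ᵇ K ∸ 1 in d≤ᵇK-1
... | true | true = ℕ.≤-refl
... | false | _ = contradiction (ℕ.≤⇒≤ᵇ 3≤d) (subst T 3≤ᵇd)
... | true | false = ℕ.≤-reflexive (ℕ.m≤n⇒m∸n≡0 {K} {d} (ℕ.≤-trans (ℕ.m≤n+m∸n K 1) d>K-1))
  where
    d>K-1 : K ∸ 1 < d
    d>K-1 = ℕ.≰⇒> (subst T d≤ᵇK-1 ∘ ℕ.≤⇒≤ᵇ {d} {K ∸ 1})

-- Arcs x → y are the codes inj₁ (x , y), drawn from tail (left) to head (right); a sparse vertex v also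
-- gets the loop inj₂ v, which takes the slot k′ at both of its ends, a slot no arc at v can use.
module BlockColouring (G : Graph) (bipartite : Bipartite G) (k′ : ℕ) (deg≤ : ∀ v → deg G v ≤ suc k′ * 2)
  where

  open BalancedOrientation (balanced-orientation G bipartite)

  V : Set
  V = Fin (n G)

  side : V → Bool
  side = proj₁ bipartite

  classes : ℕ
  classes = suc k′

  Sparse : V → Set
  Sparse v = 3 ≤ deg G v × deg G v ≤ k′ * 2

  sparse? : Decidable Sparse
  sparse? v = (3 ℕ.≤? deg G v) ×-dec (deg G v ℕ.≤? k′ * 2)

  Link : V → Set
  Link v = deg G v ≡ 2

  link-not-sparse : ∀ {v} → Link v → ¬ Sparse v
  link-not-sparse link (3≤d , _) = contradiction (subst (3 ≤_) link 3≤d) (ℕ.<-irrefl refl)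

  link? : Decidable Link
  link? v = deg G v ℕ.≟ 2

  links : List V
  links = List.filter link? (List.allFin (n G))

  out-flip : ∀ {x y b} → y ∈ N G x → out x y ≡ b → out y x ≡ not b
  out-flip y∈N o = trans (out-antisym y∈N) (cong not o)

  slot<classes : ∀ {v u} → u ∈ N G v → slot G v u < classes
  slot<classes {v} u∈N = m<n*o⇒m/o<n (ℕ.<-≤-trans (rank<deg G u∈N) (deg≤ v))

  slot<k′ : ∀ {v u} → Sparse v → u ∈ N G v → slot G v u < k′
  slot<k′ (_ , d≤2k′) u∈N = m<n*o⇒m/o<n (ℕ.<-≤-trans (rank<deg G u∈N) d≤2k′)

  slot≡0 : ∀ {v u} → Link v → u ∈ N G v → slot G v u ≡ 0
  slot≡0 {v} {u} link u∈N = m<n⇒m/n≡0 (subst (rank G v u <_) link (rank<deg G u∈N))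

  toℕ-slot-mod : ∀ {v u} → u ∈ N G v → toℕ (slot G v u mod classes) ≡ slot G v u
  toℕ-slot-mod u∈N = trans (toℕ-fromℕ< _) (m<n⇒m%n≡m (slot<classes u∈N))

  slot-mod-injective : ∀ {v u u′} → u ∈ N G v → u′ ∈ N G v →
    slot G v u mod classes ≡ slot G v u′ mod classes → slot G v u ≡ slot G v u′
  slot-mod-injective u∈N u′∈N eq = trans (sym (toℕ-slot-mod u∈N)) (trans (cong toℕ eq) (toℕ-slot-mod u′∈N))

  slot-mod≢k′ : ∀ {v u} → Sparse v → u ∈ N G v → slot G v u mod classes ≢ Fin.fromℕ k′
  slot-mod≢k′ sparse u∈N eq =
    ℕ.<⇒≢ (slot<k′ sparse u∈N) (trans (sym (toℕ-slot-mod u∈N)) (trans (cong toℕ eq) (Fin.toℕ-fromℕ k′)))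

  Code : Set
  Code = (V × V) ⊎ V

  Active : Code → Set
  Active (inj₁ (x , y)) = y ∈ N G x × out x y ≡ true
  Active (inj₂ v) = Sparse v

  active? : Decidable Active
  active? (inj₁ (x , y)) = (y Subset.∈? N G x) ×-dec (out x y Bool.≟ true)
  active? (inj₂ v) = sparse? v

  code : Fin (n G * n G + n G) ↔ Code
  code = (*↔× ⊎-↔ ↔-id _) ↔-∘ +↔⊎

  open CodedEdges code Active active?
  open Inverse code using () renaming (from to encode)

  tail head : Code → V
  tail (inj₁ (x , _)) = x
  tail (inj₂ v) = v
  head (inj₁ (_ , y)) = y
  head (inj₂ v) = v

  slotᵗ slotʰ : Code → Fin classes
  slotᵗ (inj₁ (x , y)) = slot G x y mod classes
  slotᵗ (inj₂ _) = Fin.fromℕ k′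
  slotʰ (inj₁ (x , y)) = slot G y x mod classes
  slotʰ (inj₂ _) = Fin.fromℕ k′

  tail-injective : ∀ {p q} → Active p → Active q → tail p ≡ tail q → slotᵗ p ≡ slotᵗ q → p ≡ q
  tail-injective {inj₁ (x , _)} {inj₁ _} (y∈N , o) (y′∈N , o′) refl eq =
    cong (inj₁ ∘ (x ,_)) (slot-injective y∈N y′∈N (trans o (sym o′)) (slot-mod-injective y∈N y′∈N eq))
  tail-injective {inj₁ _} {inj₂ _} (y∈N , _) sparse refl eq = contradiction eq (slot-mod≢k′ sparse y∈N)
  tail-injective {inj₂ _} {inj₁ _} sparse (y∈N , _) refl eq = contradiction (sym eq) (slot-mod≢k′ sparse y∈N)
  tail-injective {inj₂ _} {inj₂ _} _ _ refl _ = refl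

  head-injective : ∀ {p q} → Active p → Active q → head p ≡ head q → slotʰ p ≡ slotʰ q → p ≡ q
  head-injective {inj₁ (x , y)} {inj₁ (x′ , _)} (y∈N , o) (y′∈N , o′) refl eq =
    cong (inj₁ ∘ (_, y)) (slot-injective x∈N x′∈N (trans (out-flip y∈N o) (sym (out-flip y′∈N o′)))
      (slot-mod-injective x∈N x′∈N eq))
    where
      x∈N : x ∈ N G y
      x∈N = adj-sym G y∈N
      x′∈N : x′ ∈ N G y
      x′∈N = adj-sym G y′∈N
  head-injective {inj₁ _} {inj₂ _} (y∈N , _) sparse refl eq =
    contradiction eq (slot-mod≢k′ sparse (adj-sym G y∈N))
  head-injective {inj₂ _} {inj₁ _} sparse (y∈N , _) refl eq =
    contradiction (sym eq) (slot-mod≢k′ sparse (adj-sym G y∈N))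
  head-injective {inj₂ _} {inj₂ _} _ _ refl _ = refl

  link-slotᵗ : ∀ {v} → Link v → ∀ {p q} → Active p → Active q → tail p ≡ v → tail q ≡ v → slotᵗ p ≡ slotᵗ q
  link-slotᵗ link {inj₁ _} {inj₁ _} (y∈N , _) (y′∈N , _) refl refl =
    cong (_mod classes) (trans (slot≡0 link y∈N) (sym (slot≡0 link y′∈N)))
  link-slotᵗ link {inj₂ _} sparse _ refl _ = contradiction sparse (link-not-sparse link)
  link-slotᵗ link {_} {inj₂ _} _ sparse _ refl = contradiction sparse (link-not-sparse link)

  link-slotʰ : ∀ {v} → Link v → ∀ {p q} → Active p → Active q → head p ≡ v → head q ≡ v → slotʰ p ≡ slotʰ q
  link-slotʰ link {inj₁ _} {inj₁ _} (y∈N , _) (y′∈N , _) refl refl =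
    cong (_mod classes) (trans (slot≡0 link (adj-sym G y∈N)) (sym (slot≡0 link (adj-sym G y′∈N))))
  link-slotʰ link {inj₂ _} sparse _ refl _ = contradiction sparse (link-not-sparse link)
  link-slotʰ link {_} {inj₂ _} _ sparse _ refl = contradiction sparse (link-not-sparse link)

  abstract
    class-colouring : Σ (Fin (n G * n G + n G) → Fin classes) λ c → Proper (end tail) c × Proper (end head) c
      × All (λ v → Joined (end tail) (end head) c (inj₁ v) (inj₁ v)) links
    class-colouring = kőnig-linked (Sum.≡-dec _≟ᶠ_ _≟ᶠ_) (Sum.≡-dec _≟ᶠ_ _≟ᶠ_)
      Sum.inj₁-injective Sum.inj₁-injective links (Unique.filter⁺ link? (Unique.allFin⁺ (n G)))
      (end tail) (end head)
      (end-degree tail slotᵗ tail-injective) (end-degree head slotʰ head-injective)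
      (All.tabulate λ v∈ → let link = proj₂ (∈-filter⁻ link? {xs = List.allFin (n G)} v∈) in
        end-at-most-one tail slotᵗ tail-injective (link-slotᵗ link) ,
        end-at-most-one head slotʰ head-injective (link-slotʰ link))

  class : Code → Fin classes
  class = proj₁ class-colouring ∘ encode

  class-proper-at-tail : ∀ {p q} → Active p → Active q → tail p ≡ tail q → class p ≡ class q → p ≡ q
  class-proper-at-tail = proper-on-codes tail (proj₁ (proj₂ class-colouring))

  class-proper-at-head : ∀ {p q} → Active p → Active q → head p ≡ head q → class p ≡ class q → p ≡ q
  class-proper-at-head = proper-on-codes head (proj₁ (proj₂ (proj₂ class-colouring)))

  class-joined-at : ∀ {v} → Link v → Joined (end tail) (end head) (proj₁ class-colouring) (inj₁ v) (inj₁ v)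
  class-joined-at {v} link =
    All.lookup (proj₂ (proj₂ (proj₂ class-colouring))) (∈-filter⁺ link? (∈-allFin v) link)

  arc : V → V → V × V
  arc v u = if out v u then (v , u) else (u , v)

  arc-out : ∀ {v u} → out v u ≡ true → arc v u ≡ (v , u)
  arc-out = Bool.if-cong

  arc-in : ∀ {v u} → out v u ≡ false → arc v u ≡ (u , v)
  arc-in = Bool.if-cong

  arc-sym : ∀ {v u} → u ∈ N G v → arc u v ≡ arc v u
  arc-sym {v} u∈N = trans (Bool.if-cong (out-antisym u∈N)) (Bool.if-not (out v _))

  arc-class : V → V → Fin classes
  arc-class v u = class (inj₁ (arc v u))

  tail-bit : V → V → Fin 2
  tail-bit v u = Inverse.from 2↔Bool (side (proj₁ (arc v u)))

  arc-colour : V × V → Fin (classes * 2)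
  arc-colour (x , y) = combine (class (inj₁ (x , y))) (Inverse.from 2↔Bool (side x))

  colour : V → V → Fin (classes * 2)
  colour v u = arc-colour (arc v u)

  tail-side-determines-out : ∀ {v u w} → u ∈ N G v → w ∈ N G v →
    side (proj₁ (arc v u)) ≡ side (proj₁ (arc v w)) → out v u ≡ out v w
  tail-side-determines-out {v} {u} {w} u∈N w∈N eq = by-cases _ _ refl refl
    where
      side-of-tail : ∀ {x} → x ∈ N G v → ∀ b → out v x ≡ b →
        side (proj₁ (arc v x)) ≡ (if b then side v else not (side v))
      side-of-tail _ true o = cong (side ∘ proj₁) (arc-out o)
      side-of-tail x∈N false o = trans (cong (side ∘ proj₁) (arc-in o)) (side-opposite G bipartite x∈N)

      by-cases : ∀ b b′ → out v u ≡ b → out v w ≡ b′ → out v u ≡ out v w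
      by-cases true true o o′ = trans o (sym o′)
      by-cases false false o o′ = trans o (sym o′)
      by-cases true false o o′ = contradiction
        (trans (sym (side-of-tail u∈N true o)) (trans eq (side-of-tail w∈N false o′))) (not-¬ refl)
      by-cases false true o o′ = contradiction
        (trans (sym (side-of-tail w∈N true o′)) (trans (sym eq) (side-of-tail u∈N false o))) (not-¬ refl)

  colour-proper : ∀ v u w → u ∈ N G v → w ∈ N G v → colour v u ≡ colour v w → u ≡ w
  colour-proper v u w u∈N w∈N eq = by-direction _ refl
    where
      class≡ : arc-class v u ≡ arc-class v w
      class≡ = proj₁ (Fin.combine-injective (arc-class v u) (tail-bit v u) (arc-class v w) (tail-bit v w) eq)

      same-out : out v u ≡ out v w
      same-out = tail-side-determines-out u∈N w∈N (Injection.injective (↔⇒↣ (↔-sym 2↔Bool))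
        (proj₂ (Fin.combine-injective (arc-class v u) (tail-bit v u) (arc-class v w) (tail-bit v w) eq)))

      by-direction : ∀ b → out v u ≡ b → u ≡ w
      by-direction true o = cong proj₂ (Sum.inj₁-injective (class-proper-at-tail (u∈N , o) (w∈N , o′) refl
        (subst₂ (λ a b → class (inj₁ a) ≡ class (inj₁ b)) (arc-out o) (arc-out o′) class≡)))
        where
          o′ : out v w ≡ true
          o′ = trans (sym same-out) o
      by-direction false o = cong proj₁ (Sum.inj₁-injective (class-proper-at-head
        (adj-sym G u∈N , out-flip u∈N o) (adj-sym G w∈N , out-flip w∈N o′) refl
        (subst₂ (λ a b → class (inj₁ a) ≡ class (inj₁ b)) (arc-in o) (arc-in o′) class≡)))
        where
          o′ : out v w ≡ false
          o′ = trans (sym same-out) o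

  colouring : ProperEdgeColouring G (classes * 2)
  colouring = record
    { α = colour
    ; α-sym = λ u v v∈N → cong arc-colour (arc-sym (adj-sym G v∈N))
    ; proper = colour-proper
    }

  same-class-at-link : ∀ {v u u′} → Link v → u ∈ N G v → u′ ∈ N G v → arc-class v u ≡ arc-class v u′
  same-class-at-link {v} {u} {u′} link u∈N u′∈N = by-direction _ _ refl refl
    where
      same-direction : out v u ≡ out v u′ → arc-class v u ≡ arc-class v u′
      same-direction o≡ =
        cong (arc-class v) (slot-injective u∈N u′∈N o≡ (trans (slot≡0 link u∈N) (sym (slot≡0 link u′∈N))))

      out-in : ∀ {x x′} → x ∈ N G v → x′ ∈ N G v → out v x ≡ true → out v x′ ≡ false →
        arc-class v x ≡ arc-class v x′
      out-in {x} {x′} x∈N x′∈N o o′ =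
        subst₂ (λ a b → class (inj₁ a) ≡ class (inj₁ b)) (sym (arc-out o)) (sym (arc-in o′))
          (class-joined-at link _ _ (end-encode tail {inj₁ (v , x)} (x∈N , o))
                                    (end-encode head {inj₁ (x′ , v)} (adj-sym G x′∈N , out-flip x′∈N o′)))

      by-direction : ∀ b b′ → out v u ≡ b → out v u′ ≡ b′ → arc-class v u ≡ arc-class v u′
      by-direction true true o o′ = same-direction (trans o (sym o′))
      by-direction false false o o′ = same-direction (trans o (sym o′))
      by-direction true false o o′ = out-in u∈N u′∈N o o′
      by-direction false true o o′ = sym (out-in u′∈N u∈N o′ o)

  arc-class≢loop-class : ∀ {v u} → Sparse v → u ∈ N G v → arc-class v u ≢ class (inj₂ v)
  arc-class≢loop-class {v} {u} sparse u∈N = by-direction _ refl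
    where
      by-direction : ∀ b → out v u ≡ b → arc-class v u ≢ class (inj₂ v)
      by-direction true o eq with () ← class-proper-at-tail {inj₁ (v , u)} {inj₂ v} (u∈N , o) sparse refl
        (subst (λ a → class (inj₁ a) ≡ class (inj₂ v)) (arc-out o) eq)
      by-direction false o eq with () ← class-proper-at-head {inj₁ (u , v)} {inj₂ v}
        (adj-sym G u∈N , out-flip u∈N o) sparse refl
        (subst (λ a → class (inj₁ a) ≡ class (inj₂ v)) (arc-in o) eq)

  Cover : V → ℕ → Set
  Cover = CyclicCover G colour

  cover-isolated : ∀ {v} → (∀ u → u ∉ N G v) → Cover v 0
  cover-isolated {v} none = record
    { colours = ⊥ ; cyclic = inj₁ ⊥-interval ; contains = λ u u∈N → contradiction u∈N (none u)
    ; added≤ = ℕ.≤-reflexive (trans (cong (_∸ deg G v) (Subset.∣⊥∣≡0 (classes * 2))) (ℕ.0∸n≡0 (deg G v))) }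

  cover-leaf : ∀ {v u} → deg G v ≤ 1 → u ∈ N G v → Cover v 0
  cover-leaf {v} {u} d≤1 u∈N = record
    { colours = ⁅ colour v u ⁆ ; cyclic = inj₁ (⁅⁆-interval _)
    ; contains = λ u′ u′∈N → subst (λ x → colour v x ∈ ⁅ colour v u ⁆)
        (rank-injective G u∈N u′∈N (trans (rank≡0 u∈N) (sym (rank≡0 u′∈N)))) (Subset.x∈⁅x⁆ _)
    ; added≤ = ℕ.≤-reflexive (trans (cong (_∸ deg G v) (Subset.∣⁅x⁆∣≡1 (colour v u)))
        (ℕ.m≤n⇒m∸n≡0 (ℕ.≤-trans (s≤s z≤n) (rank<deg G u∈N)))) }
    where
      rank≡0 : ∀ {x} → x ∈ N G v → rank G v x ≡ 0
      rank≡0 x∈N = ℕ.n<1⇒n≡0 (ℕ.<-≤-trans (rank<deg G x∈N) d≤1)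

  cover-link : ∀ {v u} → Link v → u ∈ N G v → Cover v 0
  cover-link {v} {u} link u∈N = record
    { colours = block (arc-class v u) ; cyclic = inj₁ (block-interval (arc-class v u))
    ; contains = λ u′ u′∈N → subst (λ a → combine a (tail-bit v u′) ∈ block (arc-class v u))
        (same-class-at-link link u∈N u′∈N) (∈-block (arc-class v u) (tail-bit v u′))
    ; added≤ = ℕ.≤-reflexive (ℕ.m≤n⇒m∸n≡0 (ℕ.≤-trans (∣block∣≤2 (arc-class v u)) (ℕ.≤-reflexive (sym link)))) }

  cover-sparse : ∀ {v} → Sparse v → Cover v (k′ * 2 ∸ deg G v)
  cover-sparse {v} sparse = record
    { colours = ∁ (block (class (inj₂ v))) ; cyclic = ∁-cyclic (block-interval (class (inj₂ v)))
    ; contains = λ u u∈N → Subset.x∉p⇒x∈∁p (arc-class≢loop-class sparse u∈N ∘ ∈-block⁻)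
    ; added≤ = ℕ.∸-monoˡ-≤ (deg G v) (begin
        ∣ ∁ (block (class (inj₂ v))) ∣           ≡⟨ Subset.∣∁p∣≡n∸∣p∣ (block (class (inj₂ v))) ⟩
        classes * 2 ∸ ∣ block (class (inj₂ v)) ∣ ≤⟨ ℕ.∸-monoʳ-≤ (classes * 2) (2≤∣block∣ (class (inj₂ v))) ⟩
        k′ * 2                                   ∎) }
    where open ℕ.≤-Reasoning

  cover-dense : ∀ {v} → k′ * 2 < deg G v → Cover v 0
  cover-dense {v} d>2k′ with deg G v ℕ.<? classes * 2
  ... | no d≮t = record
    { colours = ⊤ ; cyclic = inj₁ ⊤-interval ; contains = λ _ _ → Subset.∈⊤
    ; added≤ = ℕ.≤-reflexive (ℕ.m≤n⇒m∸n≡0 (ℕ.≤-trans (ℕ.≤-reflexive (Subset.∣⊤∣≡n _)) (ℕ.≮⇒≥ d≮t))) }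
  ... | yes d<t with x , missing ← missing-colour (λ u → u Subset.∈? N G v) (colour v)
                                     (λ _ → rank-index G) (rank-index-injective G) d<t = record
    { colours = ∁ ⁅ x ⁆ ; cyclic = ∁-cyclic (⁅⁆-interval x)
    ; contains = λ u u∈N → Subset.x∉p⇒x∈∁p (missing u u∈N ∘ Subset.x∈⁅y⁆⇒x≡y x)
    ; added≤ = ℕ.≤-reflexive (ℕ.m≤n⇒m∸n≡0 (begin
        ∣ ∁ ⁅ x ⁆ ∣             ≡⟨ Subset.∣∁p∣≡n∸∣p∣ ⁅ x ⁆ ⟩
        classes * 2 ∸ ∣ ⁅ x ⁆ ∣ ≡⟨ cong (classes * 2 ∸_) (Subset.∣⁅x⁆∣≡1 x) ⟩
        suc (k′ * 2)            ≤⟨ d>2k′ ⟩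
        deg G v                 ∎)) }
    where open ℕ.≤-Reasoning

  cover-not-sparse : ∀ v → ¬ Sparse v → Cover v 0
  cover-not-sparse v ¬sparse with any? (λ u → u Subset.∈? N G v)
  ... | no none = cover-isolated (λ u u∈N → none (u , u∈N))
  ... | yes (u , u∈N) with deg G v ℕ.≤? 1 | deg G v ℕ.≟ 2
  ...   | yes d≤1 | _ = cover-leaf d≤1 u∈N
  ...   | no _ | yes link = cover-link link u∈N
  ...   | no d≰1 | no d≢2 = cover-dense (ℕ.≰⇒> (¬sparse ∘ (3≤d ,_)))
    where
      3≤d : 3 ≤ deg G v
      3≤d = ℕ.≤∧≢⇒< (ℕ.≰⇒> d≰1) (d≢2 ∘ sym)

  cover : ∀ v → Cover v (excess (k′ * 2) (deg G v))
  cover v with sparse? v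
  ... | yes sparse@(3≤d , d≤2k′) = CyclicCover-weaken (∸≤excess 3≤d d≤2k′) (cover-sparse sparse)
  ... | no ¬sparse = CyclicCover-weaken z≤n (cover-not-sparse v ¬sparse)

defc-bipartite : (G : Graph) → Bipartite G → ∀ k′ → (∀ v → deg G v ≤ suc k′ * 2) →
  DefcAtMost G (ΣV G (λ v → excess (k′ * 2) (deg G v)))
defc-bipartite G bipartite k′ deg≤ = DefcAtMost-from-covers colouring _ cover
  where open BlockColouring G bipartite k′ deg≤

even-or-odd : ∀ Δ → ∃[ h ] (Δ ≡ h * 2 ⊎ Δ ≡ 1 + h * 2)
even-or-odd Δ with Δ % 2 | m≡m%n+[m/n]*n Δ 2 | m%n<n Δ 2
... | 0 | Δ≡ | _ = Δ / 2 , inj₁ Δ≡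
... | 1 | Δ≡ | _ = Δ / 2 , inj₂ Δ≡
... | suc (suc _) | _ | s≤s (s≤s ())

deg≤maxDeg : ∀ G v → deg G v ≤ maxDeg G
deg≤maxDeg G = ≤-max (deg G)
  where
    ≤-max : (f : Fin m → ℕ) (i : Fin m) → f i ≤ foldr _⊔_ 0 (List.tabulate f)
    ≤-max f zero = ℕ.m≤m⊔n (f zero) _
    ≤-max f (suc i) = ℕ.≤-trans (≤-max (f ∘ suc) i) (ℕ.m≤n⊔m (f zero) _)

bound-even : ∀ G k′ → maxDeg G ≡ suc k′ * 2 → bound G ≡ ΣV G (λ v → excess (k′ * 2) (deg G v))
bound-even G k′ Δ≡ with maxDeg G % 2 | trans (cong (_% 2) Δ≡) (m*n%n≡0 (suc k′) 2)
... | zero | _ rewrite Δ≡ = refl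

bound-odd : ∀ G k′ → maxDeg G ≡ 1 + k′ * 2 → bound G ≡ ΣV G (λ v → excess (k′ * 2) (deg G v))
bound-odd G k′ Δ≡ with maxDeg G % 2 | trans (cong (_% 2) Δ≡) ([m+kn]%n≡m%n 1 k′ 2)
... | suc _ | _ rewrite Δ≡ = refl

-- Δ ≥ 5 is only used to exclude Δ = 0.
proposition1 : (G : Graph) → Bipartite G → 5 ≤ maxDeg G → DefcAtMost G (bound G)
proposition1 G bipartite 5≤Δ with even-or-odd (maxDeg G)
... | zero , inj₁ Δ≡0 = contradiction (subst (5 ≤_) Δ≡0 5≤Δ) λ ()
... | suc k′ , inj₁ Δ≡ = subst (DefcAtMost G) (sym (bound-even G k′ Δ≡))
  (defc-bipartite G bipartite k′ λ v → subst (deg G v ≤_) Δ≡ (deg≤maxDeg G v))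
... | k′ , inj₂ Δ≡ = subst (DefcAtMost G) (sym (bound-odd G k′ Δ≡))
  (defc-bipartite G bipartite k′ λ v → ℕ.≤-trans (deg≤maxDeg G v) (ℕ.≤-trans (ℕ.≤-reflexive Δ≡) (ℕ.n≤1+n _)))
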